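{- For any nonempty zero-set $\mathcal{Z}$, $\mu(\mathcal{Z})\ge\max\{\mu(\mathcal{Z}^{\downarrow1}),\mu(\mathcal{Z}^{\leftarrow1})\}$ and $\mu_{\mathrm{en}}(\mathcal{Z})\ge\max\{\mu_{\mathrm{en}}(\mathcal{Z}^{\downarrow1}),\mu_{\mathrm{en}}(\mathcal{Z}^{\leftarrow1})\}$.
   Context: $\mathbb{Z}_+=\{0,1,2,\dots\}$, $\mathbb{N}=\{1,2,\dots\}$. For $a,b\in\mathbb{N}$, $R_{a,b}=([0,a-1]\times[0,b-1])\cap\mathbb{Z}_+^2$; a zero-set is a union of $R_{a,b}$ over a finite $\mathcal{I}\subseteq\mathbb{N}^2$ (possibly empty). $X^{\downarrow1}=\{(u,v-1):(u,v)\in X,v\ge1\}$, $X^{\leftarrow1}=\{(u-1,v):(u,v)\in X,u\ge1\}$. For $x\in\mathbb{Z}_+^2$ and $A\subseteq\mathbb{Z}_+^2$, $\mathtt{row}(x,A)$, $\mathtt{col}(x,A)$ are the numbers of points of $A$ on the horizontal and vertical lines through $x$. Regular dynamics: $\mathcal{T}(A)=A\cup\{x\notin A:(\mathtt{row}(x,A),\mathtt{col}(x,A))\notin\mathcal{Z}\}$; $A$ spans if $\bigcup_t\mathcal{T}^t(A)=\mathbb{Z}_+^2$; $\tau(\mathcal{Z},A)=\min\{t\in\mathbb{N}:\mathcal{T}^t(A)=\mathbb{Z}_+^2\}$; $\mu(\mathcal{Z})$ is the supremum of $\tau(\mathcal{Z},A)$ over finite spanning $A$. Enhanced dynamics: enhancements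 $\vec r,\vec c$ are weakly decreasing sequences of nonnegative integers; $\mathcal{T}_{\mathrm{en}}(A)=A\cup\{(i,j):(\mathtt{row}((i,j),A)+r_j,\mathtt{col}((i,j),A)+c_i)\notin\mathcal{Z}\}$; $(\vec r,\vec c)$ spans if $\bigcup_t\mathcal{T}_{\mathrm{en}}^t(\emptyset)=\mathbb{Z}_+^2$; $\tau_{\mathrm{en}}(\mathcal{Z},\vec r,\vec c)=\inf\{t\in\mathbb{N}:\mathcal{T}_{\mathrm{en}}^t(\emptyset)=\mathbb{Z}_+^2\}$; $\mu_{\mathrm{en}}(\mathcal{Z})$ is the maximum of $\tau_{\mathrm{en}}$ over spanning pairs with finite support. -}

module Defs where

open import Data.Nat using (ℕ; zero; suc; _+_; _∸_; _≤_; _<_)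
open import Data.Fin using (Fin)
open import Data.Product using (Σ; ∃; ∃₂; _×_; _,_)
open import Data.Sum using (_⊎_)
open import Data.List using (List)
open import Data.List.Relation.Unary.Any using (Any)
open import Data.List.Membership.Propositional using (_∈_)
open import Relation.Nullary using (¬_)
open import Relation.Binary.PropositionalEquality using (_≡_)
open import Function.Definitions using (Injective)

-- Points of ℤ₊² are pairs (i , j) : ℕ × ℕ ; i is the first (horizontal)
-- coordinate, j the second (vertical) one.
Point : Set
Point = ℕ × ℕ

Subset : Set₁
Subset = Point → Set

R : ℕ → ℕ → Subset
R a b (u , v) = (u < a) × (v < b)

ZeroSet : List (ℕ × ℕ) → Subset
ZeroSet I x = Any (λ ab → R (Data.Product.proj₁ ab) (Data.Product.proj₂ ab) x) I

PositiveIndex : List (ℕ × ℕ) → Set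
PositiveIndex I = ∀ {a b} → (a , b) ∈ I → (1 ≤ a) × (1 ≤ b)

shiftDown : Subset → Subset
shiftDown X x = ∃₂ λ u v → X (u , v) × (1 ≤ v) × (x ≡ (u , v ∸ 1))

shiftLeft : Subset → Subset
shiftLeft X x = ∃₂ λ u v → X (u , v) × (1 ≤ u) × (x ≡ (u ∸ 1 , v))

RowAtLeast : Subset → ℕ → ℕ → Set
RowAtLeast A j k = Σ (Fin k → ℕ) λ f → Injective _≡_ _≡_ f × (∀ m → A (f m , j))

ColAtLeast : Subset → ℕ → ℕ → Set
ColAtLeast A i k = Σ (Fin k → ℕ) λ f → Injective _≡_ _≡_ f × (∀ m → A (i , f m))

-- row((i,j),A) = k  (exactly k points; infinite counts are never "exactly k")
RowIs : Subset → ℕ → ℕ → Set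
RowIs A j k = RowAtLeast A j k × ¬ RowAtLeast A j (suc k)

ColIs : Subset → ℕ → ℕ → Set
ColIs A i k = ColAtLeast A i k × ¬ ColAtLeast A i (suc k)

-- (row(x,A), col(x,A)) ∈ Z   (an infinite count is never in Z ⊆ ℕ²)
CountsInZ : Subset → Subset → Point → Set
CountsInZ Z A (i , j) = ∃₂ λ r c → RowIs A j r × ColIs A i c × Z (r , c)

T : Subset → Subset → Subset
T Z A x = A x ⊎ (¬ A x × ¬ CountsInZ Z A x)

iterT : Subset → ℕ → Subset → Subset
iterT Z zero    A = A
iterT Z (suc t) A = T Z (iterT Z t A)

Full : Subset → Set
Full A = ∀ x → A x

fin : List Point → Subset
fin L x = x ∈ L

Spans : Subset → Subset → Set
Spans Z A = ∀ x → ∃ λ t → iterT Z t A x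

-- τ(Z,A) ≥ n  : no t ∈ ℕ = {1,2,..} with t < n has T^t(A) = ℤ₊²
-- (this is correct also when τ = ∞, i.e. the set of such t is empty)
TauAtLeast : Subset → Subset → ℕ → Set
TauAtLeast Z A n = ∀ t → 1 ≤ t → t < n → ¬ Full (iterT Z t A)

-- μ(Z) ≥ n  (μ is a supremum in ℕ ∪ {∞})
MuAtLeast : Subset → ℕ → Set
MuAtLeast Z n = ∃ λ (L : List Point) → Spans Z (fin L) × TauAtLeast Z (fin L) n

MuGe : Subset → Subset → Set
MuGe Z Z' = ∀ n → MuAtLeast Z' n → MuAtLeast Z n

WeaklyDecreasing : (ℕ → ℕ) → Set
WeaklyDecreasing s = ∀ m n → m ≤ n → s n ≤ s m

FiniteSupport : (ℕ → ℕ) → Set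
FiniteSupport s = ∃ λ N → ∀ n → N ≤ n → s n ≡ 0

CountsInZen : Subset → (ℕ → ℕ) → (ℕ → ℕ) → Subset → Point → Set
CountsInZen Z r c A (i , j) =
  ∃₂ λ p q → RowIs A j p × ColIs A i q × Z (p + r j , q + c i)

Ten : Subset → (ℕ → ℕ) → (ℕ → ℕ) → Subset → Subset
Ten Z r c A x = A x ⊎ ¬ CountsInZen Z r c A x

iterTen : Subset → (ℕ → ℕ) → (ℕ → ℕ) → ℕ → Subset → Subset
iterTen Z r c zero    A = A
iterTen Z r c (suc t) A = Ten Z r c (iterTen Z r c t A)

empty : Subset
empty _ = Data.Empty.⊥
  where import Data.Empty

SpansEn : Subset → (ℕ → ℕ) → (ℕ → ℕ) → Set
SpansEn Z r c = ∀ x → ∃ λ t → iterTen Z r c t empty x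

TauEnAtLeast : Subset → (ℕ → ℕ) → (ℕ → ℕ) → ℕ → Set
TauEnAtLeast Z r c n = ∀ t → 1 ≤ t → t < n → ¬ Full (iterTen Z r c t empty)

MuEnAtLeast : Subset → ℕ → Set
MuEnAtLeast Z n = ∃₂ λ (r c : ℕ → ℕ) →
  WeaklyDecreasing r × WeaklyDecreasing c × FiniteSupport r × FiniteSupport c ×
  SpansEn Z r c × TauEnAtLeast Z r c n

MuEnGe : Subset → Subset → Set
MuEnGe Z Z' = ∀ n → MuEnAtLeast Z' n → MuEnAtLeast Z n

module Submission where

-- Run the Z-dynamics on the seed of a Z↓¹-run moved one row up,
-- completed in the regular case by the segment [0,W) × {0} (W bounds the width
-- of Z) and in the enhanced case by raising the bottom row enhancement by W.
-- After one step the bottom row is full; above it every column carries one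
-- extra occupied point, which exactly compensates the downward shift of the
-- zero-set.  Hence the lifted run contains the Z↓¹-run moved one row up with a
-- lag of one step ('lift') and is contained in it without lag ('lower'): it
-- spans whenever the original run does and is never full earlier.
--
-- Left shift.  Transposing ℤ₊² exchanges rows and columns, turns Z←¹ into
-- (Zᵀ)↓¹ and commutes with both dynamics, so it is the down case for Zᵀ.
--
-- Nonemptiness and positivity of the index list are not needed.

open import Defs
open import Data.Nat using (ℕ; zero; suc; _+_; _≤_; _<_; z≤n; s≤s; pred)
open import Data.Nat.Properties
open import Data.Nat.ListAction using (sum)
open import Data.Fin using (Fin; toℕ; inject≤; punchIn) renaming (zero to fzero; suc to fsuc)
open import Data.Fin.Properties using (inject≤-injective; punchIn-injective; punchInᵢ≢i; toℕ-injective; toℕ<n)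
  renaming (any? to any-index?; suc-injective to fsuc-injective)
open import Data.Product using (Σ; ∃; _×_; _,_; proj₁; proj₂; swap)
open import Data.Product.Properties using (≡-dec)
open import Data.List using (List; _∷_; map; _++_; applyUpTo)
open import Data.List.Relation.Unary.Any as Any using (here; there; any?)
open import Data.List.Membership.Propositional using (_∈_)
open import Data.List.Membership.Propositional.Properties
  using (∈-map⁺; ∈-map⁻; ∈-++⁺ˡ; ∈-++⁺ʳ; ∈-++⁻; ∈-applyUpTo⁺; ∈-applyUpTo⁻)
open import Data.List.Membership.DecPropositional (≡-dec _≟_ _≟_) using (_∈?_)
open import Data.Sum using (_⊎_; inj₁; inj₂)
open import Data.Empty using (⊥-elim)
open import Function using (_∘_; id)
open import Function.Definitions using (Injective)
open import Relation.Nullary using (¬_; yes; no)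
open import Relation.Nullary.Decidable using (¬¬-excluded-middle; _×-dec_; ¬?; map′)
open import Relation.Unary using (Decidable; _⊆_; _≐_)
open import Relation.Unary.Properties using (≐-sym)
open import Relation.Binary.PropositionalEquality using (_≡_; _≢_; refl; sym; trans; cong; cong₂; subst)

private
  variable
    P Q : ℕ → Set
    k m n p q : ℕ

AtLeast : (ℕ → Set) → ℕ → Set
AtLeast P k = Σ (Fin k → ℕ) λ f → Injective _≡_ _≡_ f × (∀ m → P (f m))

Exactly : (ℕ → Set) → ℕ → Set
Exactly P k = AtLeast P k × ¬ AtLeast P (suc k)

atLeast-zero : AtLeast P 0
atLeast-zero = (λ ()) , (λ { {()} }) , (λ ())

atLeast-map : (g : ℕ → ℕ) → (∀ {u} → P u → Q (g u)) →
  (∀ {u v} → P u → P v → g u ≡ g v → u ≡ v) → AtLeast P k → AtLeast Q k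
atLeast-map g keeps injective (f , f-inj , f∈P) =
  g ∘ f , (λ {a} {b} e → f-inj (injective (f∈P a) (f∈P b) e)) , keeps ∘ f∈P

atLeast-⊆ : P ⊆ Q → AtLeast P k → AtLeast Q k
atLeast-⊆ {P = P} {Q = Q} P⊆Q = atLeast-map {P = P} {Q = Q} id P⊆Q (λ _ _ e → e)

atLeast-≤ : m ≤ n → AtLeast P n → AtLeast P m
atLeast-≤ m≤n (f , f-inj , f∈P) =
  (λ i → f (inject≤ i m≤n)) , (λ e → inject≤-injective m≤n m≤n _ _ (f-inj e)) , (λ i → f∈P (inject≤ i m≤n))

exactly-unique : Exactly P m → Exactly P n → m ≡ n
exactly-unique {P = P} (≥m , ≱m+1) (≥n , ≱n+1) =
  ≤-antisym (≮⇒≥ λ n<m → ≱n+1 (atLeast-≤ {P = P} n<m ≥m)) (≮⇒≥ λ m<n → ≱m+1 (atLeast-≤ {P = P} m<n ≥n))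

exactly-≐ : P ≐ Q → Exactly P k → Exactly Q k
exactly-≐ {P = P} {Q = Q} (P⊆Q , Q⊆P) (≥k , ≱k+1) =
  atLeast-⊆ {P = P} {Q = Q} P⊆Q ≥k , ≱k+1 ∘ atLeast-⊆ {P = Q} {Q = P} Q⊆P

atLeast-cons : ∀ {v} → P v → AtLeast (λ u → P u × u ≢ v) k → AtLeast P (suc k)
atLeast-cons {P = P} {v = v} Pv (f , f-inj , f∈) = g , g-inj , g∈P
  where
  g : Fin (suc _) → ℕ
  g fzero    = v
  g (fsuc m) = f m
  g-inj : Injective _≡_ _≡_ g
  g-inj {fzero}  {fzero}  _ = refl
  g-inj {fzero}  {fsuc b} e = ⊥-elim (proj₂ (f∈ b) (sym e))
  g-inj {fsuc a} {fzero}  e = ⊥-elim (proj₂ (f∈ a) e)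
  g-inj {fsuc a} {fsuc b} e = cong fsuc (f-inj e)
  g∈P : ∀ m → P (g m)
  g∈P fzero    = Pv
  g∈P (fsuc m) = proj₁ (f∈ m)

atLeast-remove : ∀ {v} → AtLeast P (suc k) → AtLeast (λ u → P u × u ≢ v) k
atLeast-remove {v = v} (f , f-inj , f∈P) with any-index? (λ m → f m ≟ v)
... | yes (m₀ , fm₀≡v) =
  f ∘ punchIn m₀ , (λ e → punchIn-injective m₀ _ _ (f-inj e)) ,
  λ m → f∈P (punchIn m₀ m) , λ e → punchInᵢ≢i m₀ m (f-inj (trans e (sym fm₀≡v)))
... | no v∉f =
  f ∘ fsuc , (λ e → fsuc-injective (f-inj e)) , λ m → f∈P (fsuc m) , λ e → v∉f (fsuc m , e)

atLeast-insert0 : Q 0 → (∀ {u} → P u → Q (suc u)) → AtLeast P k → AtLeast Q (suc k)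
atLeast-insert0 {Q = Q} {P = P} Q0 P⊆Q∘suc =
  atLeast-cons {P = Q} Q0 ∘
  atLeast-map {P = P} {Q = λ u → Q u × u ≢ 0} suc (λ Pu → P⊆Q∘suc Pu , λ ()) (λ _ _ → suc-injective)

atLeast-drop0 : (∀ {u} → Q (suc u) → P u) → AtLeast Q (suc k) → AtLeast P k
atLeast-drop0 {Q = Q} {P = P} Q∘suc⊆P =
  atLeast-map {P = λ u → Q u × u ≢ 0} {Q = P} pred keeps injective ∘ atLeast-remove {P = Q}
  where
  keeps : ∀ {u} → Q u × u ≢ 0 → P (pred u)
  keeps {zero}  (_ , u≢0) = ⊥-elim (u≢0 refl)
  keeps {suc u} (Qu , _)  = Q∘suc⊆P Qu
  injective : ∀ {u v} → Q u × u ≢ 0 → Q v × v ≢ 0 → pred u ≡ pred v → u ≡ v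
  injective {zero}          (_ , u≢0) _         _ = ⊥-elim (u≢0 refl)
  injective {suc u} {zero}  _         (_ , v≢0) _ = ⊥-elim (v≢0 refl)
  injective {suc u} {suc v} _         _         e = cong suc e

-- Classically, a predicate with at most k elements has an exact count, which
-- is ≤ k.  All comparisons of counts below aim at a contradiction, so stating
-- them double-negated costs nothing.
exactly-below : ¬ AtLeast P (suc k) → ¬ ¬ (∃ λ k′ → Exactly P k′ × k′ ≤ k)
exactly-below {P = P} {k = zero} ≱1 none = none (0 , (atLeast-zero {P = P} , ≱1) , z≤n)
exactly-below {P = P} {k = suc k} ≱k+2 none = ¬¬-excluded-middle λ where
  (yes ≥k+1) → none (suc k , (≥k+1 , ≱k+2) , ≤-refl)
  (no ≱k+1)  → exactly-below {P = P} ≱k+1 λ (k′ , exact , k′≤k) → none (k′ , exact , m≤n⇒m≤1+n k′≤k)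

count-⊆ : Q ⊆ P → Exactly P p → ¬ ¬ (∃ λ p′ → Exactly Q p′ × p′ ≤ p)
count-⊆ {Q = Q} {P = P} Q⊆P (_ , ≱p+1) = exactly-below {P = Q} (≱p+1 ∘ atLeast-⊆ {P = Q} {Q = P} Q⊆P)

count-drop0 : (∀ {v} → Q (suc v) → P v) → Exactly P q → ¬ ¬ (∃ λ q′ → Exactly Q q′ × q′ ≤ suc q)
count-drop0 {Q = Q} {P = P} Q∘suc⊆P (_ , ≱q+1) =
  exactly-below {P = Q} (≱q+1 ∘ atLeast-drop0 {Q = Q} {P = P} Q∘suc⊆P)

count-insert0 : Q 0 → (∀ {v} → P v → Q (suc v)) → Exactly Q q → ¬ ¬ (∃ λ q′ → Exactly P q′ × suc q′ ≤ q)
count-insert0 {Q = Q} {P = P} {q = zero} Q0 P⊆Q∘suc (_ , ≱1) _ =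
  ≱1 (atLeast-insert0 {Q = Q} {P = P} Q0 P⊆Q∘suc (atLeast-zero {P = P}))
count-insert0 {Q = Q} {P = P} {q = suc q} Q0 P⊆Q∘suc (_ , ≱q+2) none =
  exactly-below {P = P} (≱q+2 ∘ atLeast-insert0 {Q = Q} {P = P} Q0 P⊆Q∘suc)
    λ (q′ , exact , q′≤q) → none (q′ , exact , s≤s q′≤q)

exactly-bounded : (P : ℕ → Set) → Decidable P → ∀ N → (∀ {u} → P u → u < N) → Σ ℕ (Exactly P)
exactly-bounded P P? zero below = 0 , atLeast-zero {P = P} , λ (f , _ , f∈P) → n≮0 (below (f∈P fzero))
exactly-bounded P P? (suc N) below with P? N
  | exactly-bounded (λ u → P u × u ≢ N) (λ u → P? u ×-dec ¬? (u ≟ N)) N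
      (λ (Pu , u≢N) → ≤∧≢⇒< (≤-pred (below Pu)) u≢N)
... | yes PN | k , ≥k , ≱k+1 = suc k , atLeast-cons {P = P} PN ≥k , ≱k+1 ∘ atLeast-remove {P = P}
... | no ¬PN | k , exact =
  k , exactly-≐ {P = λ u → P u × u ≢ N} {Q = P} (proj₁ , λ Pu → Pu , λ { refl → ¬PN Pu }) exact

count-or-infinite : (P : ℕ → Set) → Decidable P → ∀ N →
  (∀ {u} → N ≤ u → P u → P N) → (∀ {u} → N ≤ u → P N → P u) → Σ ℕ (Exactly P) ⊎ (∀ k → AtLeast P k)
count-or-infinite P P? N to-N from-N with P? N
... | yes PN = inj₂ λ k →
  (λ m → N + toℕ m) , (λ e → toℕ-injective (+-cancelˡ-≡ N _ _ e)) , λ m → from-N (m≤m+n N (toℕ m)) PN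
... | no ¬PN = inj₁ (exactly-bounded P P? N λ {u} Pu → ≰⇒> λ N≤u → ¬PN (to-N N≤u Pu))

Row : Subset → ℕ → ℕ → Set
Row A j u = A (u , j)

Column : Subset → ℕ → ℕ → Set
Column A i v = A (i , v)

-- Finite sets are tame and the regular dynamics keeps
-- tameness; this is what makes its iterates decidable.
record Tame (N : ℕ) (A : Subset) : Set where
  field
    decide      : Decidable A
    column-copy : ∀ {i} → N ≤ i → Column A i ≐ Column A N
    row-copy    : ∀ {j} → N ≤ j → Row A j ≐ Row A N

module _ {N : ℕ} {A : Subset} (tame : Tame N A) where
  open Tame tame

  row-count : ∀ j → Σ ℕ (RowIs A j) ⊎ (∀ k → RowAtLeast A j k)
  row-count j = count-or-infinite (Row A j) (λ u → decide (u , j)) N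
    (λ N≤u → proj₁ (column-copy N≤u)) (λ N≤u → proj₂ (column-copy N≤u))

  column-count : ∀ i → Σ ℕ (ColIs A i) ⊎ (∀ k → ColAtLeast A i k)
  column-count i = count-or-infinite (Column A i) (λ v → decide (i , v)) N
    (λ N≤v → proj₁ (row-copy N≤v)) (λ N≤v → proj₂ (row-copy N≤v))

  -- Infinite lines never count; finite ones have unique counts to test against Z.
  counts-decidable : ∀ {Z} → Decidable Z → Decidable (CountsInZ Z A)
  counts-decidable {Z} Z? (i , j) with row-count j | column-count i
  ... | inj₂ infinite | _ = no λ (r , _ , row , _) → proj₂ row (infinite (suc r))
  ... | inj₁ _ | inj₂ infinite = no λ (_ , c , _ , col , _) → proj₂ col (infinite (suc c))
  ... | inj₁ (r , row) | inj₁ (c , col) = map′ (λ z → r , c , row , col , z) same-counts (Z? (r , c))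
    where
    same-counts : CountsInZ Z A (i , j) → Z (r , c)
    same-counts (r′ , c′ , row′ , col′ , z) =
      subst Z (cong₂ _,_ (exactly-unique {P = Row A j} row′ row) (exactly-unique {P = Column A i} col′ col)) z

-- The regular update of a point depends only on the point's row and column, so
-- equal columns (rows) of A give equal columns (rows) of T Z A.
T-column-transfer : ∀ {Z A i i′} → Column A i ≐ Column A i′ → Column (T Z A) i ⊆ Column (T Z A) i′
T-column-transfer (to , from) (inj₁ a) = inj₁ (to a)
T-column-transfer {Z} {A} {i} {i′} (to , from) (inj₂ (¬a , ¬counts)) =
  inj₂ (¬a ∘ from , λ (r , c , row , col , z) → ¬counts (r , c , row , exactly-≐ {P = Column A i′} (from , to) col , z))

T-row-transfer : ∀ {Z A j j′} → Row A j ≐ Row A j′ → Row (T Z A) j ⊆ Row (T Z A) j′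
T-row-transfer (to , from) (inj₁ a) = inj₁ (to a)
T-row-transfer {Z} {A} {j} {j′} (to , from) (inj₂ (¬a , ¬counts)) =
  inj₂ (¬a ∘ from , λ (r , c , row , col , z) → ¬counts (r , c , exactly-≐ {P = Row A j′} (from , to) row , col , z))

T-tame : ∀ {Z N A} → Decidable Z → Tame N A → Tame N (T Z A)
T-tame {Z} {N} {A} Z? tame = record
  { decide      = decide′
  ; column-copy = λ N≤i → T-column-transfer {Z} {A} (column-copy N≤i) , T-column-transfer {Z} {A} (≐-sym (column-copy N≤i))
  ; row-copy    = λ N≤j → T-row-transfer {Z} {A} (row-copy N≤j) , T-row-transfer {Z} {A} (≐-sym (row-copy N≤j))
  }
  where
  open Tame tame
  decide′ : Decidable (T Z A)
  decide′ x with decide x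
  ... | yes a = yes (inj₁ a)
  ... | no ¬a = map′ (λ ¬counts → inj₂ (¬a , ¬counts)) (λ { (inj₁ a) → ⊥-elim (¬a a) ; (inj₂ (_ , ¬counts)) → ¬counts })
                     (¬? (counts-decidable tame Z? x))

iterT-tame : ∀ {Z N A} → Decidable Z → Tame N A → ∀ t → Tame N (iterT Z t A)
iterT-tame Z? tame zero    = tame
iterT-tame Z? tame (suc t) = T-tame Z? (iterT-tame Z? tame t)

bound : List Point → ℕ
bound = sum ∘ map (λ (a , b) → suc (a + b))

inside-bound : ∀ {L a b} → (a , b) ∈ L → a + b < bound L
inside-bound (here refl)           = m≤m+n _ _
inside-bound {_ ∷ L} (there a,b∈L) = <-≤-trans (inside-bound a,b∈L) (m≤n+m _ _)

-- Beyond the bound, all lines of a finite set are empty.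
fin-tame : ∀ L → Tame (bound L) (fin L)
fin-tame L = record
  { decide      = _∈? L
  ; column-copy = λ N≤i → (⊥-elim ∘ beyond-column N≤i) , (⊥-elim ∘ beyond-column ≤-refl)
  ; row-copy    = λ N≤j → (⊥-elim ∘ beyond-row N≤j) , (⊥-elim ∘ beyond-row ≤-refl)
  }
  where
  beyond-column : ∀ {i v} → bound L ≤ i → ¬ (i , v) ∈ L
  beyond-column {i} {v} N≤i i,v∈L = <⇒≱ (≤-<-trans (m≤m+n i v) (inside-bound i,v∈L)) N≤i
  beyond-row : ∀ {u j} → bound L ≤ j → ¬ (u , j) ∈ L
  beyond-row {u} {j} N≤j u,j∈L = <⇒≱ (≤-<-trans (m≤n+m j u) (inside-bound u,j∈L)) N≤j

DownClosed : Subset → Set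
DownClosed Z = ∀ {a b a′ b′} → Z (a , b) → a′ ≤ a → b′ ≤ b → Z (a′ , b′)

WidthBelow : ℕ → Subset → Set
WidthBelow W Z = ∀ {a b} → Z (a , b) → a < W

shiftDown-elim : ∀ {Z i j} → shiftDown Z (i , j) → Z (i , suc j)
shiftDown-elim (_ , suc _ , z , _ , refl) = z

shiftDown-intro : ∀ {Z i j} → Z (i , suc j) → shiftDown Z (i , j)
shiftDown-intro z = _ , _ , z , s≤s z≤n , refl

shiftLeft-elim : ∀ {Z i j} → shiftLeft Z (i , j) → Z (suc i , j)
shiftLeft-elim (suc _ , _ , z , _ , refl) = z

shiftLeft-intro : ∀ {Z i j} → Z (suc i , j) → shiftLeft Z (i , j)
shiftLeft-intro z = _ , _ , z , s≤s z≤n , refl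

shiftDown-decidable : ∀ {Z} → Decidable Z → Decidable (shiftDown Z)
shiftDown-decidable Z? (i , j) = map′ shiftDown-intro shiftDown-elim (Z? (i , suc j))

_ᵀ : Subset → Subset
A ᵀ = A ∘ swap

transpose-involutive : ∀ {A} → A ≐ (A ᵀ) ᵀ
transpose-involutive = id , id

transpose-flip : ∀ {X Y} → X ≐ Y ᵀ → Y ≐ X ᵀ
transpose-flip (X⊆Yᵀ , Yᵀ⊆X) = Yᵀ⊆X , X⊆Yᵀ

transpose-closed : ∀ {Z} → DownClosed Z → DownClosed (Z ᵀ)
transpose-closed closed z a′≤a b′≤b = closed z b′≤b a′≤a

shift-transpose : ∀ {Z} → shiftDown (Z ᵀ) ≐ (shiftLeft Z) ᵀ
shift-transpose {Z} = (λ {(i , j)} → shiftLeft-intro {Z} ∘ shiftDown-elim {Z ᵀ}) ,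
                      (λ {(i , j)} → shiftDown-intro {Z ᵀ} ∘ shiftLeft-elim {Z})

-- Both dynamics commute with transposition: rows of X are columns of Y and
-- the two counts swap roles (as do the two enhancements).
T-transpose-⊆ : ∀ {Z Z′ X Y} → Z′ ≐ Z ᵀ → X ≐ Y ᵀ → T Z′ X ⊆ (T Z Y) ᵀ
T-transpose-⊆ hZ hX (inj₁ x) = inj₁ (proj₁ hX x)
T-transpose-⊆ {Z} {Z′} {X} {Y} hZ (X⊆Yᵀ , Yᵀ⊆X) {i , j} (inj₂ (¬x , ¬counts)) =
  inj₂ (¬x ∘ Yᵀ⊆X , λ (r , c , row , col , z) →
    ¬counts (c , r , exactly-≐ {P = Column Y j} (Yᵀ⊆X , X⊆Yᵀ) col ,
                     exactly-≐ {P = Row Y i} (Yᵀ⊆X , X⊆Yᵀ) row , proj₂ hZ z))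

T-transpose : ∀ {Z Z′ X Y} → Z′ ≐ Z ᵀ → X ≐ Y ᵀ → T Z′ X ≐ (T Z Y) ᵀ
T-transpose {Z} {Z′} hZ hX =
  T-transpose-⊆ {Z} hZ hX , λ {x} → T-transpose-⊆ {Z′} (transpose-flip hZ) (transpose-flip hX) {swap x}

iterT-transpose : ∀ {Z Z′ X Y} → Z′ ≐ Z ᵀ → X ≐ Y ᵀ → ∀ t → iterT Z′ t X ≐ (iterT Z t Y) ᵀ
iterT-transpose hZ hX zero        = hX
iterT-transpose {Z} hZ hX (suc t) = T-transpose {Z} hZ (iterT-transpose {Z} hZ hX t)

Ten-transpose-⊆ : ∀ {Z Z′ r c X Y} → Z′ ≐ Z ᵀ → X ≐ Y ᵀ → Ten Z′ c r X ⊆ (Ten Z r c Y) ᵀ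
Ten-transpose-⊆ hZ hX (inj₁ x) = inj₁ (proj₁ hX x)
Ten-transpose-⊆ {Z} {Z′} {r} {c} {X} {Y} hZ (X⊆Yᵀ , Yᵀ⊆X) {i , j} (inj₂ ¬counts) =
  inj₂ λ (p , q , row , col , z) →
    ¬counts (q , p , exactly-≐ {P = Column Y j} (Yᵀ⊆X , X⊆Yᵀ) col ,
                     exactly-≐ {P = Row Y i} (Yᵀ⊆X , X⊆Yᵀ) row , proj₂ hZ z)

Ten-transpose : ∀ {Z Z′ r c X Y} → Z′ ≐ Z ᵀ → X ≐ Y ᵀ → Ten Z′ c r X ≐ (Ten Z r c Y) ᵀ
Ten-transpose {Z} {Z′} {r} {c} hZ hX =
  Ten-transpose-⊆ {Z} {r = r} {c} hZ hX ,
  λ {x} → Ten-transpose-⊆ {Z′} {r = c} {r} (transpose-flip hZ) (transpose-flip hX) {swap x}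

iterTen-transpose : ∀ {Z Z′ r c} → Z′ ≐ Z ᵀ → ∀ t → iterTen Z′ c r t empty ≐ (iterTen Z r c t empty) ᵀ
iterTen-transpose hZ zero = (λ ()) , (λ ())
iterTen-transpose {Z} {r = r} {c} hZ (suc t) =
  Ten-transpose {Z} {r = r} {c} hZ (iterTen-transpose {Z} {r = r} {c} hZ t)

fin-transpose : ∀ L → fin (map swap L) ≐ (fin L) ᵀ
fin-transpose L = from-map , ∈-map⁺ swap
  where
  from-map : ∀ {x} → x ∈ map swap L → swap x ∈ L
  from-map x∈ with ∈-map⁻ swap x∈
  ... | y , y∈L , refl = y∈L

mu-transpose : ∀ {Z Z′} → Z′ ≐ Z ᵀ → ∀ n → MuAtLeast Z n → MuAtLeast Z′ n
mu-transpose {Z} {Z′} hZ n (L , spans , slow) = map swap L , spans′ , slow′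
  where
  dynamics : ∀ t → iterT Z′ t (fin (map swap L)) ≐ (iterT Z t (fin L)) ᵀ
  dynamics = iterT-transpose {Z} hZ (fin-transpose L)
  spans′ : Spans Z′ (fin (map swap L))
  spans′ x = let (t , x∈) = spans (swap x) in t , proj₂ (dynamics t) x∈
  slow′ : TauAtLeast Z′ (fin (map swap L)) n
  slow′ t 1≤t t<n full = slow t 1≤t t<n λ y → proj₁ (dynamics t) (full (swap y))

mu-en-transpose : ∀ {Z Z′} → Z′ ≐ Z ᵀ → ∀ n → MuEnAtLeast Z n → MuEnAtLeast Z′ n
mu-en-transpose {Z} {Z′} hZ n (r , c , r↓ , c↓ , r-finite , c-finite , spans , slow) =
  c , r , c↓ , r↓ , c-finite , r-finite , spans′ , slow′
  where
  dynamics : ∀ t → iterTen Z′ c r t empty ≐ (iterTen Z r c t empty) ᵀ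
  dynamics = iterTen-transpose {Z} {r = r} {c} hZ
  spans′ : SpansEn Z′ c r
  spans′ x = let (t , x∈) = spans (swap x) in t , proj₂ (dynamics t) x∈
  slow′ : TauEnAtLeast Z′ c r n
  slow′ t 1≤t t<n full = slow t 1≤t t<n λ y → proj₁ (dynamics t) (full (swap y))

spans-lifted : ∀ {B C : ℕ → Subset} → (∀ t {i j} → B t (i , j) → C (suc t) (i , suc j)) →
  (∀ i → C 1 (i , 0)) → (∀ x → ∃ λ t → B t x) → ∀ x → ∃ λ t → C t x
spans-lifted lift bottom spans (i , zero)  = 1 , bottom i
spans-lifted lift bottom spans (i , suc j) = let (t , b) = spans (i , j) in suc t , lift t b

full-lowered : ∀ {B C : ℕ → Subset} → (∀ t {i j} → C t (i , suc j) → B t (i , j)) →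
  ∀ t → Full (C t) → Full (B t)
full-lowered lower t full (i , j) = lower t (full (i , suc j))

raise : Point → Point
raise (i , j) = i , suc j

-- Regular dynamics: C starts from L raised by one row plus [0,W) × {0}.
-- In 'lower' and 'lift' the row through a point keeps its count and the column
-- gains (at most, resp. at least) the bottom point, which matches Z↓¹ against Z.
module RegularDownShift {Z : Subset} {W : ℕ} (Z? : Decidable Z) (closed : DownClosed Z)
                        (narrow : WidthBelow W Z) (L : List Point) where

  seed : List Point
  seed = map raise L ++ applyUpTo (λ i → i , 0) W

  B C : ℕ → Subset
  B t = iterT (shiftDown Z) t (fin L)
  C t = iterT Z t (fin seed)

  B? : ∀ t → Decidable (B t)
  B? t = Tame.decide (iterT-tame (shiftDown-decidable Z?) (fin-tame L) t)

  C? : ∀ t → Decidable (C t)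
  C? t = Tame.decide (iterT-tame Z? (fin-tame seed) t)

  seed-lowered : ∀ {i j} → (i , suc j) ∈ seed → (i , j) ∈ L
  seed-lowered i,j+1∈ with ∈-++⁻ (map raise L) i,j+1∈
  ... | inj₁ raised with ∈-map⁻ raise raised
  ...   | _ , i,j∈L , refl = i,j∈L
  seed-lowered i,j+1∈ | inj₂ on-bottom with ∈-applyUpTo⁻ (λ i → i , 0) on-bottom
  ...   | _ , _ , ()

  bottom-segment : RowAtLeast (C 0) 0 W
  bottom-segment = toℕ , toℕ-injective , λ m → ∈-++⁺ʳ (map raise L) (∈-applyUpTo⁺ (λ i → i , 0) (toℕ<n m))

  lower : ∀ t {i j} → C t (i , suc j) → B t (i , j)
  lower zero c = seed-lowered c
  lower (suc t) (inj₁ c) = inj₁ (lower t c)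
  lower (suc t) {i} {j} (inj₂ (_ , ¬counts)) with B? t (i , j)
  ... | yes b = inj₁ b
  ... | no ¬b = inj₂ (¬b , λ (p , q , row , col , z) →
        count-⊆ {Q = Row (C t) (suc j)} {P = Row (B t) j} (lower t) row λ (p′ , row′ , p′≤p) →
        count-drop0 {Q = Column (C t) i} {P = Column (B t) i} (lower t) col λ (q′ , col′ , q′≤1+q) →
        ¬counts (p′ , q′ , row′ , col′ , closed (shiftDown-elim z) p′≤p q′≤1+q))

  -- The bottom row of the seed already has W points, more than any row count in Z.
  bottom : ∀ t i → C (suc t) (i , 0)
  bottom zero i with C? 0 (i , 0)
  ... | yes c = inj₁ c
  ... | no ¬c = inj₂ (¬c , λ (p , _ , row , _ , z) → proj₂ row (atLeast-≤ {P = Row (C 0) 0} (narrow z) bottom-segment))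
  bottom (suc t) i = inj₁ (bottom t i)

  lift : ∀ t {i j} → B t (i , j) → C (suc t) (i , suc j)
  lift zero b = inj₁ (∈-++⁺ˡ (∈-map⁺ raise b))
  lift (suc t) (inj₁ b) = inj₁ (lift t b)
  lift (suc t) {i} {j} (inj₂ (_ , ¬counts)) with C? (suc t) (i , suc j)
  ... | yes c = inj₁ c
  ... | no ¬c = inj₂ (¬c , λ (p′ , q′ , row′ , col′ , z) →
        count-⊆ {Q = Row (B t) j} {P = Row (C (suc t)) (suc j)} (lift t) row′ λ (p , row , p≤p′) →
        count-insert0 {Q = Column (C (suc t)) i} {P = Column (B t) i} (bottom t i) (lift t) col′ λ (q , col , 1+q≤q′) →
        ¬counts (p , q , row , col , shiftDown-intro (closed z p≤p′ 1+q≤q′)))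

regular-down : ∀ {Z W} → Decidable Z → DownClosed Z → WidthBelow W Z → MuGe Z (shiftDown Z)
regular-down Z? closed narrow n (L , spans , slow) =
  seed , spans-lifted {B} {C} lift (bottom 0) spans , λ t 1≤t t<n → slow t 1≤t t<n ∘ full-lowered {B} {C} lower t
  where open RegularDownShift Z? closed narrow L

boost-bottom : (ℕ → ℕ) → ℕ → ℕ → ℕ
boost-bottom r W zero    = r 0 + W
boost-bottom r W (suc j) = r j

boost-decreasing : ∀ {r} W → WeaklyDecreasing r → WeaklyDecreasing (boost-bottom r W)
boost-decreasing W r↓ zero zero _ = ≤-refl
boost-decreasing {r} W r↓ zero (suc n) _ = ≤-trans (r↓ 0 n z≤n) (m≤m+n (r 0) W)
boost-decreasing W r↓ (suc m) (suc n) (s≤s m≤n) = r↓ m n m≤n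

boost-finite : ∀ {r} W → FiniteSupport r → FiniteSupport (boost-bottom r W)
boost-finite W (N , vanishes) = suc N , λ { (suc n) (s≤s N≤n) → vanishes n N≤n }

module EnhancedDownShift {Z : Subset} {W : ℕ} (closed : DownClosed Z) (narrow : WidthBelow W Z)
                         (r c : ℕ → ℕ) where

  B C : ℕ → Subset
  B t = iterTen (shiftDown Z) r c t empty
  C t = iterTen Z (boost-bottom r W) c t empty

  lower : ∀ t {i j} → C t (i , suc j) → B t (i , j)
  lower zero ()
  lower (suc t) (inj₁ c) = inj₁ (lower t c)
  lower (suc t) {i} {j} (inj₂ ¬counts) = inj₂ λ (p , q , row , col , z) →
    count-⊆ {Q = Row (C t) (suc j)} {P = Row (B t) j} (lower t) row λ (p′ , row′ , p′≤p) →
    count-drop0 {Q = Column (C t) i} {P = Column (B t) i} (lower t) col λ (q′ , col′ , q′≤1+q) →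
    ¬counts (p′ , q′ , row′ , col′ , closed (shiftDown-elim z) (+-monoˡ-≤ (r j) p′≤p) (+-monoˡ-≤ (c i) q′≤1+q))

  -- The boost alone pushes every bottom-row count beyond the width of Z.
  bottom : ∀ t i → C (suc t) (i , 0)
  bottom zero i = inj₂ λ (p , _ , _ , _ , z) → <⇒≱ (narrow z) (≤-trans (m≤n+m W (r 0)) (m≤n+m _ p))
  bottom (suc t) i = inj₁ (bottom t i)

  lift : ∀ t {i j} → B t (i , j) → C (suc t) (i , suc j)
  lift zero ()
  lift (suc t) (inj₁ b) = inj₁ (lift t b)
  lift (suc t) {i} {j} (inj₂ ¬counts) = inj₂ λ (p′ , q′ , row′ , col′ , z) →
    count-⊆ {Q = Row (B t) j} {P = Row (C (suc t)) (suc j)} (lift t) row′ λ (p , row , p≤p′) →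
    count-insert0 {Q = Column (C (suc t)) i} {P = Column (B t) i} (bottom t i) (lift t) col′ λ (q , col , 1+q≤q′) →
    ¬counts (p , q , row , col , shiftDown-intro (closed z (+-monoˡ-≤ (r j) p≤p′) (+-monoˡ-≤ (c i) 1+q≤q′)))

enhanced-down : ∀ {Z W} → DownClosed Z → WidthBelow W Z → MuEnGe Z (shiftDown Z)
enhanced-down {W = W} closed narrow n (r , c , r↓ , c↓ , r-finite , c-finite , spans , slow) =
  boost-bottom r W , c , boost-decreasing W r↓ , c↓ , boost-finite W r-finite , c-finite ,
  spans-lifted {B} {C} lift (bottom 0) spans , λ t 1≤t t<n → slow t 1≤t t<n ∘ full-lowered {B} {C} lower t
  where open EnhancedDownShift closed narrow r c

regular-left : ∀ {Z} → MuGe (Z ᵀ) (shiftDown (Z ᵀ)) → MuGe Z (shiftLeft Z)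
regular-left {Z} down n =
  mu-transpose {Z ᵀ} transpose-involutive n ∘ down n ∘ mu-transpose {shiftLeft Z} shift-transpose n

enhanced-left : ∀ {Z} → MuEnGe (Z ᵀ) (shiftDown (Z ᵀ)) → MuEnGe Z (shiftLeft Z)
enhanced-left {Z} down n =
  mu-en-transpose {Z ᵀ} transpose-involutive n ∘ down n ∘ mu-en-transpose {shiftLeft Z} shift-transpose n

zeroSet-decidable : ∀ I → Decidable (ZeroSet I)
zeroSet-decidable I (i , j) = any? (λ (a , b) → (i <? a) ×-dec (j <? b)) I

zeroSet-closed : ∀ I → DownClosed (ZeroSet I)
zeroSet-closed I z a′≤a b′≤b = Any.map (λ (a<u , b<v) → ≤-<-trans a′≤a a<u , ≤-<-trans b′≤b b<v) z

zeroSet-bounded : ∀ {I a b} → ZeroSet I (a , b) → a < sum (map proj₁ I) × b < sum (map proj₂ I)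
zeroSet-bounded (here (a<u , b<v)) = <-≤-trans a<u (m≤m+n _ _) , <-≤-trans b<v (m≤m+n _ _)
zeroSet-bounded {_ ∷ I} (there z) =
  let (a< , b<) = zeroSet-bounded {I} z in <-≤-trans a< (m≤n+m _ _) , <-≤-trans b< (m≤n+m _ _)

lemma2p8 : (I : List (ℕ × ℕ)) → PositiveIndex I → Σ Point (ZeroSet I) →
    (MuGe (ZeroSet I) (shiftDown (ZeroSet I)) × MuGe (ZeroSet I) (shiftLeft (ZeroSet I)))
    × (MuEnGe (ZeroSet I) (shiftDown (ZeroSet I)) × MuEnGe (ZeroSet I) (shiftLeft (ZeroSet I)))
lemma2p8 I _ _ =
  (regular-down Z? closed wide , regular-left {Z} (regular-down (Z? ∘ swap) (transpose-closed {Z} closed) tall)) ,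
  (enhanced-down closed wide , enhanced-left {Z} (enhanced-down (transpose-closed {Z} closed) tall))
  where
  Z : Subset
  Z = ZeroSet I
  Z? : Decidable Z
  Z? = zeroSet-decidable I
  closed : DownClosed Z
  closed = zeroSet-closed I
  wide : WidthBelow (sum (map proj₁ I)) Z
  wide = proj₁ ∘ zeroSet-bounded {I}
  tall : WidthBelow (sum (map proj₂ I)) (Z ᵀ)
  tall = proj₂ ∘ zeroSet-bounded {I}
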